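{- Let $n\ge 2$ be an integer, $p$ a prime, $s\ge 2$ an integer and $\gamma\in\mathbb{Z}$. There does not exist an almost $p$-ary sequence of period $n+s$ with $s$ zero-symbols occupying $s$ consecutive positions whose out-of-phase autocorrelation coefficients $C_{\underline{a}}(t)$, $1\le t\le n+s-1$, are all equal to $\gamma$ (i.e. an almost $p$-ary NPS of type $\gamma$).
   Context: $\zeta_p\in\mathbb{C}$ is a fixed primitive $p$-th root of unity. An almost $p$-ary sequence of period $N$ with $s$ zero-symbols is a periodic complex sequence of period $N$ such that in one period exactly $s$ entries are $0$ and every other entry is of the form $\zeta_p^{b}$ for some integer $b$. The autocorrelation function is $C_{\underline{a}}(t)=\sum_{i=0}^{N-1}a_i\overline{a_{i+t}}$ (indices modulo $N$). -}

module Defs where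

open import Data.Nat using (ℕ; zero; suc; _+_; _∸_; _<_)
open import Data.Nat.DivMod using (_mod_)
open import Data.Fin using (Fin; toℕ)
import Data.Fin as F
open import Data.Integer using (ℤ; +_) renaming (_-_ to _-ℤ_; _+_ to _+ℤ_)
open import Data.List using (List; map)
open import Data.Nat.ListAction using (sum)
open import Data.List using () renaming (allFin to allFinL)
open import Data.Maybe using (Maybe; just; nothing)
open import Data.Product using (∃; _×_)
open import Data.Bool using (if_then_else_)
open import Relation.Nullary.Decidable using (⌊_⌋)
open import Relation.Binary.PropositionalEquality using (_≡_)

-- An almost p-ary sequence of period N (one period):
-- nothing  = the zero symbol,  just b  = ζ_p ^ b  (b ∈ ℤ/p).
Seq : ℕ → ℕ → Set
Seq N p = Fin N → Maybe (Fin p)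

shift : ∀ {N} → Fin N → ℕ → Fin N
shift {suc N} i t = (toℕ i + t) mod suc N

sub : ∀ {p} → Fin p → Fin p → Fin p
sub {suc p} x y = (toℕ x + (suc p ∸ toℕ y)) mod suc p

-- The ring ℤ[ζ_p] = ℤ[x]/(Φ_p(x)) realised as the group ring ℤ[ℤ/p] modulo the
-- all-ones element 1 + ζ + … + ζ^(p-1).  An element is a coefficient vector
-- c : Fin p → ℤ  standing for  Σ_k c k · ζ_p^k.
Cyc : ℕ → Set
Cyc p = Fin p → ℤ

_≈ζ_ : ∀ {p} → Cyc p → Cyc p → Set
x ≈ζ y = ∃ λ (m : ℤ) → ∀ k → x k -ℤ y k ≡ m

intC : ∀ {p} → ℤ → Cyc p
intC {suc p} γ k = if ⌊ k F.≟ F.zero ⌋ then γ else + 0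

-- contribution of index i to the coefficient of ζ^k in a_i · conj(a_{i+t});
-- conj(ζ^y) = ζ^(-y), so ζ^x · conj(ζ^y) = ζ^(x - y); a zero symbol contributes 0.
term : ∀ {p} → Maybe (Fin p) → Maybe (Fin p) → Fin p → ℕ
term (just x) (just y) k = if ⌊ sub x y F.≟ k ⌋ then 1 else 0
term _        _        k = 0

autocorr : ∀ {N p} → Seq N p → ℕ → Cyc p
autocorr {N} a t k = + sum (map (λ i → term (a i) (a (shift i t)) k) (allFinL N))

isZero : ∀ {p} → Maybe (Fin p) → ℕ
isZero nothing  = 1
isZero (just _) = 0

numZeros : ∀ {N p} → Seq N p → ℕ
numZeros {N} a = sum (map (λ i → isZero (a i)) (allFinL N))

ZerosConsecutive : ∀ {N p} → Seq N p → ℕ → Set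
ZerosConsecutive {N} a s =
  ∃ λ (j : Fin N) → ∀ (i : Fin N) →
    ((a i ≡ nothing → toℕ (sub i j) < s) × (toℕ (sub i j) < s → a i ≡ nothing))

-- Summing the coefficients of C_a(t) ∈ ℤ[ζ_p] counts the indices i at which both a_i and
-- a_{i+t} are nonzero.  This augmentation is only defined modulo p on ℤ[ζ_p], because
-- 1 + ζ + … + ζ^(p-1) = 0 has augmentation p; hence C_a(1) = C_a(2) = γ forces the two
-- counts to agree modulo p.  When the zeros form a single block of length s ≥ 2 and the
-- nonzero block has length n ≥ 2, the counts are n - 1 and n - 2, and p ∣ 1 is absurd.
module Submission where

open import Defs
open import Data.Nat using (ℕ; _+_; _∸_; _≤_)
open import Data.Nat.Primality using (Prime)
open import Data.Integer using (ℤ)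
open import Data.Product using (∃; _×_)
open import Relation.Nullary using (¬_)
open import Relation.Binary.PropositionalEquality using (_≡_)

open import Data.Nat using (zero; suc; _*_; _<_; s≤s; s≤s⁻¹; z≤n; z<s; _%_; _≤?_; NonZero)
open import Data.Nat.Properties
open import Data.Nat.DivMod using (m%n<n; m<n⇒m%n≡m; n%n≡0; [m+n]%n≡m%n; %-distribˡ-+; m%n%n≡m%n)
open import Data.Nat.Primality using (¬prime[1])
open import Data.Fin as F using (Fin; toℕ; punchIn)
open import Data.Fin.Properties using (toℕ-injective; toℕ-fromℕ<; toℕ<n; punchInᵢ≢i)
open import Data.List using (map; tabulate) renaming (allFin to allFinL)
open import Data.List.Properties using (map-tabulate)
open import Data.Nat.ListAction using (sum)
open import Data.Maybe using (Maybe; just; nothing)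
open import Data.Bool using (if_then_else_)
open import Data.Product using (_,_; proj₁; proj₂)
open import Data.Empty using (⊥-elim)
open import Function using (id; _∘_)
open import Relation.Nullary using (yes; no)
open import Relation.Nullary.Decidable using (⌊_⌋)
open import Relation.Binary.PropositionalEquality
  using (_≢_; refl; sym; trans; cong; cong₂; subst; module ≡-Reasoning)
open import Relation.Binary.Definitions using (tri<; tri≈; tri>)
open import Data.Integer using (+_; 1ℤ; -_; ∣_∣) renaming (_+_ to _+ℤ_; _-_ to _-ℤ_; _*_ to _*ℤ_)
import Data.Integer.Properties as ℤ
open import Data.Integer.Tactic.RingSolver using (solve-∀)
open import Algebra.Properties.CommutativeMonoid.Sum ℤ.+-0-commutativeMonoid
  using (sum-syntax; ∑-comm; ∑-distrib-+; sum-cong-≗; sum-replicate-zero; sum-remove)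
open import Algebra.Properties.CommutativeSemigroup +-commutativeSemigroup using (xy∙z≈xz∙y)
open import Algebra.Properties.AbelianGroup ℤ.+-0-abelianGroup using (∙-cancelʳ)

open ≡-Reasoning

∑-const : ∀ n (c : ℤ) → ∑[ i < n ] c ≡ + n *ℤ c
∑-const zero    c = sym (ℤ.*-zeroˡ c)
∑-const (suc n) c = trans (cong (c +ℤ_) (∑-const n c)) (sym (ℤ.suc-* (+ n) c))

sum-tabulate : ∀ {n} (f : Fin n → ℕ) → + sum (tabulate f) ≡ ∑[ i < n ] (+ f i)
sum-tabulate {zero}  f = refl
sum-tabulate {suc n} f = cong (+ f F.zero +ℤ_) (sum-tabulate (f ∘ F.suc))

sum-allFin : ∀ {n} (f : Fin n → ℕ) → + sum (map f (allFinL n)) ≡ ∑[ i < n ] (+ f i)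
sum-allFin f = trans (cong (+_ ∘ sum) (map-tabulate id f)) (sum-tabulate f)

δ : ∀ {n} → Fin n → Fin n → ℕ
δ c i = if ⌊ c F.≟ i ⌋ then 1 else 0

δ-refl : ∀ {n} (c : Fin n) → δ c c ≡ 1
δ-refl c with c F.≟ c
... | yes _  = refl
... | no c≢c = ⊥-elim (c≢c refl)

δ-≢ : ∀ {n} {c i : Fin n} → c ≢ i → δ c i ≡ 0
δ-≢ {c = c} {i} c≢i with c F.≟ i
... | yes c≡i = ⊥-elim (c≢i c≡i)
... | no _    = refl

∑-δ : ∀ {n} (c : Fin n) → ∑[ i < n ] (+ δ c i) ≡ 1ℤ
∑-δ {suc n} c = begin
  ∑[ i < suc n ] (+ δ c i)                     ≡⟨ sum-remove {i = c} (λ i → + δ c i) ⟩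
  + δ c c +ℤ ∑[ i < n ] (+ δ c (punchIn c i))  ≡⟨ cong₂ _+ℤ_ (cong +_ (δ-refl c)) ∑-rest ⟩
  1ℤ                                           ∎
  where
  ∑-rest : ∑[ i < n ] (+ δ c (punchIn c i)) ≡ + 0
  ∑-rest = trans (sum-cong-≗ (λ i → cong +_ (δ-≢ (punchInᵢ≢i c i ∘ sym)))) (sum-replicate-zero n)

augmentation : ∀ {p} → Cyc p → ℤ
augmentation {p} x = ∑[ k < p ] x k

≈ζ-sym : ∀ {p} {x y : Cyc p} → x ≈ζ y → y ≈ζ x
≈ζ-sym {x = x} {y} (m , x-y≡m) = - m , λ k → trans (flip (x k) (y k)) (cong -_ (x-y≡m k))
  where
  flip : ∀ u v → v -ℤ u ≡ - (u -ℤ v)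
  flip = solve-∀

≈ζ-trans : ∀ {p} {x y z : Cyc p} → x ≈ζ y → y ≈ζ z → x ≈ζ z
≈ζ-trans {x = x} {y} {z} (m , x-y≡m) (m′ , y-z≡m′) =
  m +ℤ m′ , λ k → trans (sym (ℤ.+-minus-telescope (x k) (y k) (z k))) (cong₂ _+ℤ_ (x-y≡m k) (y-z≡m′ k))

augmentation-≈ζ : ∀ {p} {x y : Cyc p} → x ≈ζ y → ∃ λ m → augmentation x ≡ + p *ℤ m +ℤ augmentation y
augmentation-≈ζ {p} {x} {y} (m , x-y≡m) = m , (begin
  ∑[ k < p ] x k                   ≡⟨ sum-cong-≗ (λ k → trans (split (x k) (y k)) (cong (_+ℤ y k) (x-y≡m k))) ⟩
  ∑[ k < p ] (m +ℤ y k)            ≡⟨ ∑-distrib-+ (λ _ → m) y ⟩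
  ∑[ k < p ] m +ℤ augmentation y   ≡⟨ cong (_+ℤ augmentation y) (∑-const p m) ⟩
  + p *ℤ m +ℤ augmentation y       ∎)
  where
  split : ∀ u v → u ≡ (u -ℤ v) +ℤ v
  split = solve-∀

+p*m≡1⇒p≡1 : ∀ p m → + p *ℤ m ≡ 1ℤ → p ≡ 1
+p*m≡1⇒p≡1 p m p*m≡1 = m*n≡1⇒m≡1 p ∣ m ∣ (trans (sym (ℤ.abs-* (+ p) m)) (cong ∣_∣ p*m≡1))

isNonZero : ∀ {A : Set} → Maybe A → ℕ
isNonZero nothing  = 0
isNonZero (just _) = 1

∑-term : ∀ {p} (x y : Maybe (Fin p)) → ∑[ k < p ] (+ term x y k) ≡ + (isNonZero x * isNonZero y)
∑-term     (just x) (just y) = ∑-δ (sub x y)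
∑-term {p}     (just x) nothing  = sum-replicate-zero p
∑-term {p}     nothing  y        = sum-replicate-zero p

supportOverlap : ∀ {N p} → Seq N p → ℕ → ℤ
supportOverlap {N} a t = ∑[ i < N ] (+ (isNonZero (a i) * isNonZero (a (shift i t))))

augmentation-autocorr : ∀ {N p} (a : Seq N p) t → augmentation (autocorr a t) ≡ supportOverlap a t
augmentation-autocorr {N} {p} a t = begin
  ∑[ k < p ] (+ sum (map (λ i → c i k) (allFinL N)))  ≡⟨ sum-cong-≗ (λ k → sum-allFin (λ i → c i k)) ⟩
  ∑[ k < p ] ∑[ i < N ] (+ c i k)                      ≡⟨ ∑-comm (λ k i → + c i k) ⟩
  ∑[ i < N ] ∑[ k < p ] (+ c i k)                      ≡⟨ sum-cong-≗ (λ i → ∑-term (a i) (a (shift i t))) ⟩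
  supportOverlap a t                                   ∎
  where
  c : Fin N → Fin p → ℕ
  c i = term (a i) (a (shift i t))

[m%n+k]%n≡[m+k]%n : ∀ m k n .{{_ : NonZero n}} → (m % n + k) % n ≡ (m + k) % n
[m%n+k]%n≡[m+k]%n m k n = begin
  (m % n + k) % n          ≡⟨ %-distribˡ-+ (m % n) k n ⟩
  (m % n % n + k % n) % n  ≡⟨ cong (λ r → (r + k % n) % n) (m%n%n≡m%n m n) ⟩
  (m % n + k % n) % n      ≡⟨ %-distribˡ-+ m k n ⟨
  (m + k) % n              ∎

module _ {N : ℕ} where

  toℕ-shift : ∀ (i : Fin (suc N)) t → toℕ (shift i t) ≡ (toℕ i + t) % suc N
  toℕ-shift i t = toℕ-fromℕ< (m%n<n (toℕ i + t) (suc N))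

  toℕ-sub : ∀ (i j : Fin (suc N)) → toℕ (sub i j) ≡ (toℕ i + (suc N ∸ toℕ j)) % suc N
  toℕ-sub i j = toℕ-fromℕ< (m%n<n (toℕ i + (suc N ∸ toℕ j)) (suc N))

  toℕ-sub-shift : ∀ (i j : Fin (suc N)) t → toℕ (sub (shift i t) j) ≡ (t + toℕ (sub i j)) % suc N
  toℕ-sub-shift i j t = begin
    toℕ (sub (shift i t) j)                  ≡⟨ toℕ-sub (shift i t) j ⟩
    (toℕ (shift i t) + d) % suc N            ≡⟨ cong (λ r → (r + d) % suc N) (toℕ-shift i t) ⟩
    ((toℕ i + t) % suc N + d) % suc N        ≡⟨ [m%n+k]%n≡[m+k]%n (toℕ i + t) d (suc N) ⟩
    (toℕ i + t + d) % suc N                  ≡⟨ cong (_% suc N) (xy∙z≈xz∙y (toℕ i) t d) ⟩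
    (toℕ i + d + t) % suc N                  ≡⟨ [m%n+k]%n≡[m+k]%n (toℕ i + d) t (suc N) ⟨
    ((toℕ i + d) % suc N + t) % suc N        ≡⟨ cong (λ r → (r + t) % suc N) (toℕ-sub i j) ⟨
    (toℕ (sub i j) + t) % suc N              ≡⟨ cong (_% suc N) (+-comm (toℕ (sub i j)) t) ⟩
    (t + toℕ (sub i j)) % suc N              ∎
    where d = suc N ∸ toℕ j

  toℕ-sub-self : ∀ (j : Fin (suc N)) → toℕ (sub j j) ≡ 0
  toℕ-sub-self j = trans (toℕ-sub j j) (trans (cong (_% suc N) (m+[n∸m]≡n (<⇒≤ (toℕ<n j)))) (n%n≡0 (suc N)))

  toℕ-sub-shift-self : ∀ (j : Fin (suc N)) {c} → c < suc N → toℕ (sub (shift j c) j) ≡ c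
  toℕ-sub-shift-self j {c} c<N = begin
    toℕ (sub (shift j c) j)     ≡⟨ toℕ-sub-shift j j c ⟩
    (c + toℕ (sub j j)) % suc N  ≡⟨ cong (λ r → (c + r) % suc N) (toℕ-sub-self j) ⟩
    (c + 0) % suc N              ≡⟨ cong (_% suc N) (+-identityʳ c) ⟩
    c % suc N                    ≡⟨ m<n⇒m%n≡m c<N ⟩
    c                            ∎

  shift-sub : ∀ (i j : Fin (suc N)) → shift j (toℕ (sub i j)) ≡ i
  shift-sub i j = toℕ-injective (begin
    toℕ (shift j (toℕ (sub i j)))              ≡⟨ toℕ-shift j (toℕ (sub i j)) ⟩
    (toℕ j + toℕ (sub i j)) % suc N            ≡⟨ cong (_% suc N) (+-comm (toℕ j) (toℕ (sub i j))) ⟩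
    (toℕ (sub i j) + toℕ j) % suc N            ≡⟨ cong (λ r → (r + toℕ j) % suc N) (toℕ-sub i j) ⟩
    ((toℕ i + d) % suc N + toℕ j) % suc N      ≡⟨ [m%n+k]%n≡[m+k]%n (toℕ i + d) (toℕ j) (suc N) ⟩
    (toℕ i + d + toℕ j) % suc N                ≡⟨ cong (_% suc N) (+-assoc (toℕ i) d (toℕ j)) ⟩
    (toℕ i + (d + toℕ j)) % suc N              ≡⟨ cong (λ r → (toℕ i + r) % suc N) (m∸n+n≡m (<⇒≤ (toℕ<n j))) ⟩
    (toℕ i + suc N) % suc N                    ≡⟨ [m+n]%n≡m%n (toℕ i) (suc N) ⟩
    toℕ i % suc N                              ≡⟨ m<n⇒m%n≡m (toℕ<n i) ⟩
    toℕ i                                      ∎)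
    where d = suc N ∸ toℕ j

step : ℕ → ℕ → ℕ
step s u = if ⌊ s ≤? u ⌋ then 1 else 0

step-≥ : ∀ {s u} → s ≤ u → step s u ≡ 1
step-≥ {s} {u} s≤u with s ≤? u
... | yes _  = refl
... | no s≰u = ⊥-elim (s≰u s≤u)

step-< : ∀ {s u} → u < s → step s u ≡ 0
step-< {s} {u} u<s with s ≤? u
... | yes s≤u = ⊥-elim (<⇒≱ u<s s≤u)
... | no _    = refl

module _ {M s : ℕ} (2≤s : 2 ≤ s) (s≤M : s ≤ M) where

  private
    N = suc (suc M)

  step-pair-≢ : ∀ {u} → u < N → u ≢ M →
                step s u * step s ((1 + u) % N) ≡ step s u * step s ((2 + u) % N)
  step-pair-≢ {u} u<N u≢M with s ≤? u | <-cmp u M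
  ... | no _ | _ = refl
  ... | yes s≤u | tri< u<M _ _
    rewrite m<n⇒m%n≡m {n = N} (s≤s (s≤s (<⇒≤ u<M))) | m<n⇒m%n≡m {n = N} (s≤s (s≤s u<M))
          | step-≥ (m≤n⇒m≤1+n s≤u) | step-≥ (m≤n⇒m≤1+n (m≤n⇒m≤1+n s≤u)) = refl
  ... | yes _ | tri≈ _ u≡M _ = ⊥-elim (u≢M u≡M)
  ... | yes _ | tri> _ _ M<u with ≤-antisym (s≤s⁻¹ u<N) M<u
  ...   | refl rewrite n%n≡0 N {{_}} | [m+n]%n≡m%n 1 N {{_}}
                     | step-< {s} {0} (<-≤-trans z<s 2≤s) | step-< {s} {1} 2≤s = refl

  step-pair-≡ : step s M * step s ((1 + M) % N) ≡ step s M * step s ((2 + M) % N) + 1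
  step-pair-≡ rewrite m<n⇒m%n≡m {n = N} ≤-refl | n%n≡0 N {{_}}
                    | step-≥ s≤M | step-≥ (m≤n⇒m≤1+n s≤M) | step-< {s} {0} (<-≤-trans z<s 2≤s) = refl

supportOverlap[1]≡supportOverlap[2]+1 : ∀ {M p s} {a : Seq (suc (suc M)) p} → 2 ≤ s → s ≤ M →
  ZerosConsecutive a s → supportOverlap a 1 ≡ supportOverlap a 2 +ℤ 1ℤ
supportOverlap[1]≡supportOverlap[2]+1 {M} {s = s} {a} 2≤s s≤M (j , window) = begin
  supportOverlap a 1                           ≡⟨ sum-cong-≗ (cong +_ ∘ overlap-step) ⟩
  ∑[ i < N ] (+ overlap₂ i +ℤ + δ i₀ i)        ≡⟨ ∑-distrib-+ (+_ ∘ overlap₂) (λ i → + δ i₀ i) ⟩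
  supportOverlap a 2 +ℤ ∑[ i < N ] (+ δ i₀ i)  ≡⟨ cong (supportOverlap a 2 +ℤ_) (∑-δ i₀) ⟩
  supportOverlap a 2 +ℤ 1ℤ                     ∎
  where
  N = suc (suc M)

  i₀ : Fin N
  i₀ = shift j M

  overlap₂ : Fin N → ℕ
  overlap₂ i = isNonZero (a i) * isNonZero (a (shift i 2))

  isNonZero-step : ∀ i → isNonZero (a i) ≡ step s (toℕ (sub i j))
  isNonZero-step i with a i in eq | s ≤? toℕ (sub i j)
  ... | nothing | yes s≤u = ⊥-elim (<⇒≱ (proj₁ (window i) eq) s≤u)
  ... | nothing | no _    = refl
  ... | just _  | yes _   = refl
  ... | just _  | no s≰u  with () ← trans (sym eq) (proj₂ (window i) (≰⇒> s≰u))

  overlap-step : ∀ i → isNonZero (a i) * isNonZero (a (shift i 1)) ≡ overlap₂ i + δ i₀ i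
  overlap-step i rewrite isNonZero-step i | isNonZero-step (shift i 1) | isNonZero-step (shift i 2)
                       | toℕ-sub-shift i j 1 | toℕ-sub-shift i j 2 with i₀ F.≟ i
  ... | yes refl rewrite toℕ-sub-shift-self j (m≤n⇒m≤1+n (n<1+n M)) = step-pair-≡ 2≤s s≤M
  ... | no i₀≢i = trans (step-pair-≢ 2≤s s≤M (toℕ<n (sub i j)) u≢M) (sym (+-identityʳ _))
    where
    u≢M : toℕ (sub i j) ≢ M
    u≢M u≡M = i₀≢i (trans (cong (shift j) (sym u≡M)) (shift-sub i j))

corollary3p1 : (n p s : ℕ) (γ : ℤ) → 2 ≤ n → Prime p → 2 ≤ s →
    ¬ (∃ λ (a : Seq (n + s) p) →
         numZeros a ≡ s × ZerosConsecutive a s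
         × (∀ (t : ℕ) → 1 ≤ t → t ≤ n + s ∸ 1 → autocorr a t ≈ζ intC γ))
-- The zero count is already fixed by ZerosConsecutive.
corollary3p1 (suc (suc n)) p s γ (s≤s (s≤s _)) p-prime 2≤s (a , _ , zeros , C≈γ) =
  ¬prime[1] (subst Prime (+p*m≡1⇒p≡1 p m p*m≡1) p-prime)
  where
  s≤n+s : s ≤ n + s
  s≤n+s = m≤n+m s n

  C₁≈γ : autocorr a 1 ≈ζ intC γ
  C₁≈γ = C≈γ 1 ≤-refl (s≤s z≤n)

  C₂≈γ : autocorr a 2 ≈ζ intC γ
  C₂≈γ = C≈γ 2 (s≤s z≤n) (s≤s (≤-trans (<-≤-trans z<s 2≤s) s≤n+s))

  C₁≈C₂ : autocorr a 1 ≈ζ autocorr a 2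
  C₁≈C₂ = ≈ζ-trans {x = autocorr a 1} {intC γ} C₁≈γ (≈ζ-sym {x = autocorr a 2} {intC γ} C₂≈γ)

  gap : ∃ λ m → augmentation (autocorr a 1) ≡ + p *ℤ m +ℤ augmentation (autocorr a 2)
  gap = augmentation-≈ζ C₁≈C₂

  m : ℤ
  m = proj₁ gap

  p*m≡1 : + p *ℤ m ≡ 1ℤ
  p*m≡1 = ∙-cancelʳ (supportOverlap a 2) (+ p *ℤ m) 1ℤ (begin
    + p *ℤ m +ℤ supportOverlap a 2           ≡⟨ cong (+ p *ℤ m +ℤ_) (augmentation-autocorr a 2) ⟨
    + p *ℤ m +ℤ augmentation (autocorr a 2)  ≡⟨ proj₂ gap ⟨
    augmentation (autocorr a 1)              ≡⟨ augmentation-autocorr a 1 ⟩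
    supportOverlap a 1                       ≡⟨ supportOverlap[1]≡supportOverlap[2]+1 2≤s s≤n+s zeros ⟩
    supportOverlap a 2 +ℤ 1ℤ                 ≡⟨ ℤ.+-comm (supportOverlap a 2) 1ℤ ⟩
    1ℤ +ℤ supportOverlap a 2                 ∎)
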